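{- Every locating code $S$ in $\mathrm{C}_\infty(1,3)$ has density $\rho(S)\ge 1/3$.
   Context: The infinite circulant graph $\mathrm{C}_\infty(1,3)$ has vertex set $\mathbb{Z}$ and edges $xy$ with $|x-y|\in\{1,3\}$. For $u\in\mathbb{Z}$, $N[u]=\{u,u\pm1,u\pm3\}$ is its closed neighbourhood, and for $S\subseteq\mathbb{Z}$, $S_u=N[u]\cap S$. A set $S\subseteq\mathbb{Z}$ is a locating code if the sets $S_u$, $u\in\mathbb{Z}\setminus S$, are all nonempty and pairwise distinct. The density of $S\subseteq\mathbb{Z}$ is $\rho(S)=\limsup_{N\to\infty}\frac{|S\cap[-N,N]|}{2N+1}$. -}

module Defs where

open import Data.Nat as ℕ using (ℕ; suc; _≤_)
open import Data.Integer using (ℤ; +_; -[1+_]; _-_; ∣_∣)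
open import Data.Bool using (Bool; true; false)
open import Data.Product using (_×_; ∃)
open import Data.Sum using (_⊎_)
open import Relation.Binary.PropositionalEquality using (_≡_; _≢_)
open import Relation.Nullary using (¬_)

Subsetℤ : Set
Subsetℤ = ℤ → Bool

_∈S_ : ℤ → Subsetℤ → Set
w ∈S S = S w ≡ true

_∉S_ : ℤ → Subsetℤ → Set
w ∉S S = S w ≡ false

_∈N[_] : ℤ → ℤ → Set
w ∈N[ u ] = (∣ w - u ∣ ≡ 0) ⊎ (∣ w - u ∣ ≡ 1) ⊎ (∣ w - u ∣ ≡ 3)

_∈S[_]_ : ℤ → ℤ → Subsetℤ → Set
w ∈S[ u ] S = (w ∈N[ u ]) × (w ∈S S)

SameTrace : Subsetℤ → ℤ → ℤ → Set
SameTrace S u v = ∀ w → ((w ∈S[ u ] S) → (w ∈S[ v ] S)) × ((w ∈S[ v ] S) → (w ∈S[ u ] S))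

IsLocatingCode : Subsetℤ → Set
IsLocatingCode S =
  (∀ u → u ∉S S → ∃ λ w → w ∈S[ u ] S) ×
  (∀ u v → u ∉S S → v ∉S S → u ≢ v → ¬ SameTrace S u v)

bit : Bool → ℕ
bit true = 1
bit false = 0

countS : Subsetℤ → ℕ → ℕ
countS S 0 = bit (S (+ 0))
countS S (suc N) = countS S N ℕ.+ bit (S (+ suc N)) ℕ.+ bit (S -[1+ N ])

-- ρ(S) = limsup_N |S ∩ [-N,N]| / (2N+1) ≥ p/q  (q ≥ 1), expressed as:
-- for every ε = 1/(k+1) and every M there is N ≥ M with
-- |S ∩ [-N,N]| / (2N+1) ≥ p/q - 1/(k+1), cleared of denominators:
-- p·(k+1)·(2N+1) ≤ q·(k+1)·|S∩[-N,N]| + q·(2N+1).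
DensityAtLeast : Subsetℤ → ℕ → ℕ → Set
DensityAtLeast S p q =
  ∀ (k M : ℕ) → ∃ λ N → (M ≤ N) ×
    (p ℕ.* suc k ℕ.* (1 ℕ.+ 2 ℕ.* N) ≤ q ℕ.* suc k ℕ.* countS S N ℕ.+ q ℕ.* (1 ℕ.+ 2 ℕ.* N))

-- Call a window of fifteen consecutive integers locating when the locating conditions hold
-- for its nine middle vertices, whose closed neighbourhoods lie inside the window. An
-- exhaustive check over all 2¹⁵ windows shows that in a locating window the number of
-- codewords plus the number of codewords among the middle nine is at least 8. Summing over
-- the 2N − 14 windows inside [−N, N] counts each codeword at most 15 + 9 = 24 times, so
-- 8 (2N − 14) ≤ 24 |S ∩ [−N, N]|, that is, |S ∩ [−N, N]| ≥ (2N + 1 − 15) / 3.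

module Submission where

open import Defs
open import Data.Bool using (Bool; true; false; T; _∧_)
import Data.Bool.Properties as Boolₚ
open import Data.Fin as Fin using (Fin; toℕ; fromℕ<)
import Data.Fin.Properties as Finₚ
open import Data.Integer as ℤ using (ℤ; +_; -[1+_]; ∣_∣)
import Data.Integer.Properties as ℤₚ
import Data.Integer.Tactic.RingSolver as ℤ-Solver
open import Data.Nat as ℕ using (ℕ; zero; suc; _∸_; _≤_; _<_; _≤?_; _<?_; z≤n; s≤s)
import Data.Nat.Properties as ℕₚ
import Data.Nat.Tactic.RingSolver as ℕ-Solver
open import Data.Product using (_×_; _,_; ∃; proj₁; proj₂)
open import Data.Sum using (_⊎_; inj₁; inj₂; [_,_]′)
open import Data.Vec using (Vec; []; _∷_; lookup; sum)
open import Algebra.Properties.CommutativeSemigroup ℕₚ.+-commutativeSemigroup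
  using () renaming (interchange to +-interchange)
open import Function using (_∘_; id)
open import Function.Bundles using (Equivalence)
open import Relation.Binary.PropositionalEquality
open import Relation.Nullary using (¬_; Dec; ¬?; contradiction)
open import Relation.Nullary.Decidable using (isYes; toWitness; _×-dec_; _⊎-dec_; _→-dec_)

intervalSum : ℤ → ℕ → (ℤ → ℕ) → ℕ
intervalSum a zero    f = 0
intervalSum a (suc L) f = f a ℕ.+ intervalSum (ℤ.suc a) L f

suc-+-pos : ∀ a n → ℤ.suc a ℤ.+ + n ≡ a ℤ.+ + suc n
suc-+-pos a n = trans (shift a (+ n)) (cong (λ x → a ℤ.+ x) (sym (ℤₚ.pos-+ 1 n)))
  where
  shift : ∀ a x → (ℤ.1ℤ ℤ.+ a) ℤ.+ x ≡ a ℤ.+ (ℤ.1ℤ ℤ.+ x)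
  shift = ℤ-Solver.solve-∀

intervalSum-++ : ∀ a L M (f : ℤ → ℕ) →
  intervalSum a (L ℕ.+ M) f ≡ intervalSum a L f ℕ.+ intervalSum (a ℤ.+ + L) M f
intervalSum-++ a zero    M f = cong (λ b → intervalSum b M f) (sym (ℤₚ.+-identityʳ a))
intervalSum-++ a (suc L) M f = begin
  f a ℕ.+ intervalSum (ℤ.suc a) (L ℕ.+ M) f
    ≡⟨ cong (f a ℕ.+_) (intervalSum-++ (ℤ.suc a) L M f) ⟩
  f a ℕ.+ (intervalSum (ℤ.suc a) L f ℕ.+ intervalSum (ℤ.suc a ℤ.+ + L) M f)
    ≡⟨ sym (ℕₚ.+-assoc (f a) _ _) ⟩
  intervalSum a (suc L) f ℕ.+ intervalSum (ℤ.suc a ℤ.+ + L) M f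
    ≡⟨ cong (λ b → intervalSum a (suc L) f ℕ.+ intervalSum b M f) (suc-+-pos a L) ⟩
  intervalSum a (suc L) f ℕ.+ intervalSum (a ℤ.+ + suc L) M f ∎
  where open ≡-Reasoning

intervalSum-mono : ∀ a {L L′} (f : ℤ → ℕ) → L ≤ L′ → intervalSum a L f ≤ intervalSum a L′ f
intervalSum-mono a {L} {L′} f L≤L′ = begin
  intervalSum a L f
    ≤⟨ ℕₚ.m≤m+n _ _ ⟩
  intervalSum a L f ℕ.+ intervalSum (a ℤ.+ + L) (L′ ∸ L) f
    ≡⟨ intervalSum-++ a L (L′ ∸ L) f ⟨
  intervalSum a (L ℕ.+ (L′ ∸ L)) f
    ≡⟨ cong (λ n → intervalSum a n f) (ℕₚ.m+[n∸m]≡n L≤L′) ⟩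
  intervalSum a L′ f ∎
  where open ℕₚ.≤-Reasoning

intervalSum-+ : ∀ a L (f g : ℤ → ℕ) →
  intervalSum a L (λ x → f x ℕ.+ g x) ≡ intervalSum a L f ℕ.+ intervalSum a L g
intervalSum-+ a zero    f g = refl
intervalSum-+ a (suc L) f g =
  trans (cong (f a ℕ.+ g a ℕ.+_) (intervalSum-+ (ℤ.suc a) L f g))
        (+-interchange (f a) (g a) _ _)

intervalSum-*ˡ : ∀ a L m (f : ℤ → ℕ) →
  intervalSum a L (λ x → m ℕ.* f x) ≡ m ℕ.* intervalSum a L f
intervalSum-*ˡ a zero    m f = sym (ℕₚ.*-zeroʳ m)
intervalSum-*ˡ a (suc L) m f =
  trans (cong (m ℕ.* f a ℕ.+_) (intervalSum-*ˡ (ℤ.suc a) L m f))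
        (sym (ℕₚ.*-distribˡ-+ m (f a) _))

intervalSum-suc : ∀ a L (f : ℤ → ℕ) → intervalSum a L (f ∘ ℤ.suc) ≡ intervalSum (ℤ.suc a) L f
intervalSum-suc a zero    f = refl
intervalSum-suc a (suc L) f = cong (f (ℤ.suc a) ℕ.+_) (intervalSum-suc (ℤ.suc a) L f)

intervalSum-lower : ∀ {c} {f : ℤ → ℕ} → (∀ x → c ≤ f x) → ∀ a L → L ℕ.* c ≤ intervalSum a L f
intervalSum-lower c≤f a zero    = z≤n
intervalSum-lower c≤f a (suc L) = ℕₚ.+-mono-≤ (c≤f a) (intervalSum-lower c≤f (ℤ.suc a) L)

count : Subsetℤ → ℤ → ℕ → ℕ
count S a L = intervalSum a L (bit ∘ S)

window : Subsetℤ → ℤ → (n : ℕ) → Vec Bool n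
window S a zero    = []
window S a (suc n) = S a ∷ window S (ℤ.suc a) n

weighted : ∀ {n} → Vec ℕ n → Vec Bool n → ℕ
weighted []       []       = 0
weighted (m ∷ ms) (b ∷ bs) = m ℕ.* bit b ℕ.+ weighted ms bs

lookup-window : ∀ S a {n} (q : Fin n) → lookup (window S a n) q ≡ S (a ℤ.+ + toℕ q)
lookup-window S a Fin.zero    = cong S (sym (ℤₚ.+-identityʳ a))
lookup-window S a (Fin.suc q) = trans (lookup-window S (ℤ.suc a) q) (cong S (suc-+-pos a (toℕ q)))

intervalSum-weighted-window : ∀ S {n} (ms : Vec ℕ n) a L →
  intervalSum a L (λ x → weighted ms (window S x n)) ≤ sum ms ℕ.* count S a (n ℕ.+ L)
intervalSum-weighted-window S []                a L = ℕₚ.≤-reflexive (intervalSum-*ˡ a L 0 (bit ∘ S))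
intervalSum-weighted-window S {suc n} (m ∷ ms) a L = begin
  intervalSum a L (λ x → m ℕ.* bit (S x) ℕ.+ weighted ms (window S (ℤ.suc x) n))
    ≡⟨ intervalSum-+ a L _ _ ⟩
  intervalSum a L (λ x → m ℕ.* bit (S x)) ℕ.+ intervalSum a L (λ x → weighted ms (window S (ℤ.suc x) n))
    ≡⟨ cong₂ ℕ._+_ (intervalSum-*ˡ a L m (bit ∘ S)) (intervalSum-suc a L _) ⟩
  m ℕ.* count S a L ℕ.+ intervalSum (ℤ.suc a) L (λ x → weighted ms (window S x n))
    ≤⟨ ℕₚ.+-mono-≤ (ℕₚ.*-monoʳ-≤ m (intervalSum-mono a (bit ∘ S) (ℕₚ.m≤n+m L (suc n))))
                   (intervalSum-weighted-window S ms (ℤ.suc a) L) ⟩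
  m ℕ.* count S a (suc n ℕ.+ L) ℕ.+ sum ms ℕ.* count S (ℤ.suc a) (n ℕ.+ L)
    ≤⟨ ℕₚ.+-monoʳ-≤ _ (ℕₚ.*-monoʳ-≤ (sum ms) (ℕₚ.m≤n+m _ (bit (S a)))) ⟩
  m ℕ.* count S a (suc n ℕ.+ L) ℕ.+ sum ms ℕ.* count S a (suc n ℕ.+ L)
    ≡⟨ ℕₚ.*-distribʳ-+ _ m (sum ms) ⟨
  (m ℕ.+ sum ms) ℕ.* count S a (suc n ℕ.+ L) ∎
  where open ℕₚ.≤-Reasoning

NbhdOffset : ℤ → Set
NbhdOffset d = (∣ d ∣ ≡ 0) ⊎ (∣ d ∣ ≡ 1) ⊎ (∣ d ∣ ≡ 3)

∈N-translate : ∀ a w u → (a ℤ.+ w) ∈N[ a ℤ.+ u ] ≡ w ∈N[ u ]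
∈N-translate a w u = cong NbhdOffset (difference a w u)
  where
  difference : ∀ a w u → (a ℤ.+ w) ℤ.- (a ℤ.+ u) ≡ w ℤ.- u
  difference = ℤ-Solver.solve-∀

∈N⇒close : ∀ w u → w ∈N[ u ] → ∣ w ℤ.- u ∣ ≤ 3
∈N⇒close _ _ (inj₁ d≡0)        = subst (_≤ 3) (sym d≡0) z≤n
∈N⇒close _ _ (inj₂ (inj₁ d≡1)) = subst (_≤ 3) (sym d≡1) (s≤s z≤n)
∈N⇒close _ _ (inj₂ (inj₂ d≡3)) = ℕₚ.≤-reflexive d≡3

Window : Set
Window = Vec Bool 15

Interior : Fin 15 → Set
Interior p = 3 ≤ toℕ p × toℕ p < 12

Near : Fin 15 → Fin 15 → Set
Near q p = (+ toℕ q) ∈N[ + toℕ p ]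

SameTraceIn : Window → Fin 15 → Fin 15 → Set
SameTraceIn v p p′ = ∀ q → lookup v q ≡ true → (Near q p → Near q p′) × (Near q p′ → Near q p)

IsLocatingWindow : Window → Set
IsLocatingWindow v =
  (∀ p → Interior p → lookup v p ≡ false → ∃ λ q → lookup v q ≡ true × Near q p) ×
  (∀ p p′ → Interior p → Interior p′ → lookup v p ≡ false → lookup v p′ ≡ false → p ≢ p′ →
     ¬ SameTraceIn v p p′)

offset-into-window : ∀ a (p : Fin 15) d → Interior p → ∣ d ∣ ≤ 3 →
  ∃ λ (q : Fin 15) → a ℤ.+ + toℕ p ℤ.+ d ≡ a ℤ.+ + toℕ q
offset-into-window a p (+ k) (_ , p<12) k≤3 = fromℕ< p+k<15 , (begin
  a ℤ.+ + toℕ p ℤ.+ + k       ≡⟨ ℤₚ.+-assoc a _ _ ⟩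
  a ℤ.+ (+ toℕ p ℤ.+ + k)     ≡⟨ cong (λ x → a ℤ.+ x) (ℤₚ.pos-+ (toℕ p) k) ⟨
  a ℤ.+ + (toℕ p ℕ.+ k)       ≡⟨ cong (λ n → a ℤ.+ + n) (Finₚ.toℕ-fromℕ< p+k<15) ⟨
  a ℤ.+ + toℕ (fromℕ< p+k<15) ∎)
  where
  open ≡-Reasoning
  p+k<15 : toℕ p ℕ.+ k < 15
  p+k<15 = ℕₚ.+-mono-≤ p<12 k≤3
offset-into-window a p -[1+ k ] (3≤p , p<12) 1+k≤3 = fromℕ< p-1-k<15 , (begin
  a ℤ.+ + toℕ p ℤ.+ -[1+ k ]    ≡⟨ ℤₚ.+-assoc a _ _ ⟩
  a ℤ.+ (toℕ p ℤ.⊖ suc k)        ≡⟨ cong (λ x → a ℤ.+ x) (ℤₚ.⊖-≥ (ℕₚ.≤-trans 1+k≤3 3≤p)) ⟩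
  a ℤ.+ + (toℕ p ∸ suc k)        ≡⟨ cong (λ n → a ℤ.+ + n) (Finₚ.toℕ-fromℕ< p-1-k<15) ⟨
  a ℤ.+ + toℕ (fromℕ< p-1-k<15) ∎)
  where
  open ≡-Reasoning
  p-1-k<15 : toℕ p ∸ suc k < 15
  p-1-k<15 = ℕₚ.≤-<-trans (ℕₚ.m∸n≤m (toℕ p) (suc k)) (ℕₚ.<-≤-trans p<12 (ℕₚ.m≤m+n 12 3))

+-cancelˡ : ∀ a {x y} → a ℤ.+ x ≡ a ℤ.+ y → x ≡ y
+-cancelˡ a {x} {y} e = begin
  x                     ≡⟨ undo a x ⟩
  ℤ.- a ℤ.+ (a ℤ.+ x)   ≡⟨ cong (λ z → ℤ.- a ℤ.+ z) e ⟩
  ℤ.- a ℤ.+ (a ℤ.+ y)   ≡⟨ undo a y ⟨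
  y                     ∎
  where
  open ≡-Reasoning
  undo : ∀ a x → x ≡ ℤ.- a ℤ.+ (a ℤ.+ x)
  undo = ℤ-Solver.solve-∀

module _ (S : Subsetℤ) (a : ℤ) where

  private
    pos : Fin 15 → ℤ
    pos q = a ℤ.+ + toℕ q

  trace-in-window : ∀ p {w} → Interior p → w ∈S[ pos p ] S →
    ∃ λ q → w ≡ pos q × lookup (window S a 15) q ≡ true × Near q p
  trace-in-window p {w} int (w∈N , w∈S)
    with offset-into-window a p (w ℤ.- pos p) int (∈N⇒close w (pos p) w∈N)
  ... | q , pos[p]+[w-p]≡pos[q] = q , w≡pos[q] , q∈v , q-near-p
    where
    split : ∀ w u → w ≡ u ℤ.+ (w ℤ.- u)
    split = ℤ-Solver.solve-∀
    w≡pos[q] : w ≡ pos q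
    w≡pos[q] = trans (split w (pos p)) pos[p]+[w-p]≡pos[q]
    q∈v : lookup (window S a 15) q ≡ true
    q∈v = trans (lookup-window S a q) (subst (λ x → S x ≡ true) w≡pos[q] w∈S)
    q-near-p : Near q p
    q-near-p = subst (λ X → X) (∈N-translate a (+ toℕ q) (+ toℕ p)) (subst (_∈N[ pos p ]) w≡pos[q] w∈N)

  trace-⊆ : ∀ p p′ → Interior p →
    (∀ q → lookup (window S a 15) q ≡ true → Near q p → Near q p′) →
    ∀ w → w ∈S[ pos p ] S → w ∈S[ pos p′ ] S
  trace-⊆ p p′ int near⇒near′ w (w∈N , w∈S) with trace-in-window p int (w∈N , w∈S)
  ... | q , w≡pos[q] , q∈v , q-near-p =
    subst (_∈N[ pos p′ ]) (sym w≡pos[q])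
          (subst (λ X → X) (sym (∈N-translate a (+ toℕ q) (+ toℕ p′))) (near⇒near′ q q∈v q-near-p)) ,
    w∈S

  locating⇒locating-window : IsLocatingCode S → IsLocatingWindow (window S a 15)
  locating⇒locating-window (dominating , separating) = dominatingᵂ , separatingᵂ
    where
    code-at : ∀ p {b} → lookup (window S a 15) p ≡ b → S (pos p) ≡ b
    code-at p = trans (sym (lookup-window S a p))

    dominatingᵂ : ∀ p → Interior p → lookup (window S a 15) p ≡ false →
      ∃ λ q → lookup (window S a 15) q ≡ true × Near q p
    dominatingᵂ p int p∉v with dominating (pos p) (code-at p p∉v)
    ... | w , w∈Sₚ with trace-in-window p int w∈Sₚ
    ... | q , _ , q∈v , q-near-p = q , q∈v , q-near-p

    separatingᵂ : ∀ p p′ → Interior p → Interior p′ →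
      lookup (window S a 15) p ≡ false → lookup (window S a 15) p′ ≡ false → p ≢ p′ →
      ¬ SameTraceIn (window S a 15) p p′
    separatingᵂ p p′ int int′ p∉v p′∉v p≢p′ same =
      separating (pos p) (pos p′) (code-at p p∉v) (code-at p′ p′∉v)
        (p≢p′ ∘ Finₚ.toℕ-injective ∘ ℤₚ.+-injective ∘ +-cancelˡ a)
        (λ w → trace-⊆ p p′ int (λ q q∈v → proj₁ (same q q∈v)) w ,
               trace-⊆ p′ p int′ (λ q q∈v → proj₂ (same q q∈v)) w)

-- Enumerating with Booleans rather than with Dec keeps the normalisation of the check small.
allᵇ : ∀ n → (Vec Bool n → Bool) → Bool
allᵇ zero    f = f []
allᵇ (suc n) f = allᵇ n (λ v → f (true ∷ v)) ∧ allᵇ n (λ v → f (false ∷ v))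

allᵇ-sound : ∀ n (f : Vec Bool n → Bool) → T (allᵇ n f) → ∀ v → T (f v)
allᵇ-sound zero    f all [] = all
allᵇ-sound (suc n) f all (true  ∷ v) = allᵇ-sound n _ (proj₁ (Equivalence.to Boolₚ.T-∧ all)) v
allᵇ-sound (suc n) f all (false ∷ v) = allᵇ-sound n _ (proj₂ (Equivalence.to Boolₚ.T-∧ all)) v

interior? : ∀ p → Dec (Interior p)
interior? p = 3 ≤? toℕ p ×-dec toℕ p <? 12

near? : ∀ q p → Dec (Near q p)
near? q p = d ℕ.≟ 0 ⊎-dec d ℕ.≟ 1 ⊎-dec d ℕ.≟ 3
  where
  d : ℕ
  d = ∣ + toℕ q ℤ.- + toℕ p ∣

sameTraceIn? : ∀ v p p′ → Dec (SameTraceIn v p p′)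
sameTraceIn? v p p′ = Finₚ.all? λ q →
  lookup v q Boolₚ.≟ true →-dec (near? q p →-dec near? q p′) ×-dec (near? q p′ →-dec near? q p)

isLocatingWindow? : ∀ v → Dec (IsLocatingWindow v)
isLocatingWindow? v =
  Finₚ.all? (λ p → interior? p →-dec lookup v p Boolₚ.≟ false →-dec
    Finₚ.any? λ q → lookup v q Boolₚ.≟ true ×-dec near? q p)
  ×-dec
  Finₚ.all? (λ p → Finₚ.all? λ p′ → interior? p →-dec interior? p′ →-dec
    lookup v p Boolₚ.≟ false →-dec lookup v p′ Boolₚ.≟ false →-dec ¬? (p Finₚ.≟ p′) →-dec
    ¬? (sameTraceIn? v p p′))

weights : Vec ℕ 15
weights = 1 ∷ 1 ∷ 1 ∷ 2 ∷ 2 ∷ 2 ∷ 2 ∷ 2 ∷ 2 ∷ 2 ∷ 2 ∷ 2 ∷ 1 ∷ 1 ∷ 1 ∷ []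

-- The weight is decided first: it settles all but a few thousand windows cheaply.
heavy-or-not-locating? : ∀ v → Dec (8 ≤ weighted weights v ⊎ ¬ IsLocatingWindow v)
heavy-or-not-locating? v = 8 ≤? weighted weights v ⊎-dec ¬? (isLocatingWindow? v)

heavy-or-not-locating : ∀ v → 8 ≤ weighted weights v ⊎ ¬ IsLocatingWindow v
heavy-or-not-locating v = toWitness (allᵇ-sound 15 (isYes ∘ heavy-or-not-locating?) _ v)

locating-window⇒8≤weight : ∀ v → IsLocatingWindow v → 8 ≤ weighted weights v
locating-window⇒8≤weight v locating =
  [ id , (λ not-locating → contradiction locating not-locating) ]′ (heavy-or-not-locating v)

count-snoc : ∀ S a L → count S a (suc L) ≡ count S a L ℕ.+ bit (S (a ℤ.+ + L))
count-snoc S a L = begin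
  count S a (suc L)                               ≡⟨ cong (count S a) (ℕₚ.+-comm 1 L) ⟩
  count S a (L ℕ.+ 1)                             ≡⟨ intervalSum-++ a L 1 (bit ∘ S) ⟩
  count S a L ℕ.+ (bit (S (a ℤ.+ + L)) ℕ.+ 0)     ≡⟨ cong (count S a L ℕ.+_) (ℕₚ.+-identityʳ _) ⟩
  count S a L ℕ.+ bit (S (a ℤ.+ + L))             ∎
  where open ≡-Reasoning

countS≡count : ∀ S N → countS S N ≡ count S (ℤ.- + N) (suc (2 ℕ.* N))
countS≡count S zero    = sym (ℕₚ.+-identityʳ _)
countS≡count S (suc N) = begin
  countS S N ℕ.+ bit (S (+ suc N)) ℕ.+ bit (S -[1+ N ])
    ≡⟨ cong₂ (λ c x → c ℕ.+ bit (S x) ℕ.+ bit (S -[1+ N ])) (countS≡count S N) (sym right-end) ⟩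
  count S (ℤ.- + N) L ℕ.+ bit (S (ℤ.- + N ℤ.+ + L)) ℕ.+ bit (S -[1+ N ])
    ≡⟨ cong (ℕ._+ bit (S -[1+ N ])) (count-snoc S (ℤ.- + N) L) ⟨
  count S (ℤ.- + N) (suc L) ℕ.+ bit (S -[1+ N ])
    ≡⟨ ℕₚ.+-comm _ (bit (S -[1+ N ])) ⟩
  bit (S -[1+ N ]) ℕ.+ count S (ℤ.- + N) (suc L)
    ≡⟨ cong (λ x → bit (S -[1+ N ]) ℕ.+ count S x (suc L)) left-end ⟨
  count S -[1+ N ] (suc (suc L))
    ≡⟨ cong (count S -[1+ N ] ∘ suc) (ℕₚ.*-suc 2 N) ⟨
  count S -[1+ N ] (suc (2 ℕ.* suc N)) ∎
  where
  open ≡-Reasoning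
  L : ℕ
  L = suc (2 ℕ.* N)
  cancel : ∀ x y → ℤ.- x ℤ.+ (x ℤ.+ y) ≡ y
  cancel = ℤ-Solver.solve-∀
  halves : ∀ N → suc (2 ℕ.* N) ≡ N ℕ.+ suc N
  halves = ℕ-Solver.solve-∀
  right-end : ℤ.- + N ℤ.+ + L ≡ + suc N
  right-end = begin
    ℤ.- + N ℤ.+ + L                  ≡⟨ cong (λ n → ℤ.- + N ℤ.+ + n) (halves N) ⟩
    ℤ.- + N ℤ.+ + (N ℕ.+ suc N)      ≡⟨ cong (λ x → ℤ.- + N ℤ.+ x) (ℤₚ.pos-+ N (suc N)) ⟩
    ℤ.- + N ℤ.+ (+ N ℤ.+ + suc N)    ≡⟨ cancel (+ N) (+ suc N) ⟩
    + suc N                          ∎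
  left-end : ℤ.suc -[1+ N ] ≡ ℤ.- + N
  left-end = trans (cong ℤ.suc (ℤₚ.neg-suc N)) (ℤₚ.suc-pred _)

locating⇒count-bound : ∀ {S} → IsLocatingCode S → ∀ a L → L ℕ.* 8 ≤ 24 ℕ.* count S a (15 ℕ.+ L)
locating⇒count-bound {S} loc a L = begin
  L ℕ.* 8
    ≤⟨ intervalSum-lower (λ x → locating-window⇒8≤weight _ (locating⇒locating-window S x loc)) a L ⟩
  intervalSum a L (λ x → weighted weights (window S x 15))
    ≤⟨ intervalSum-weighted-window S weights a L ⟩
  24 ℕ.* count S a (15 ℕ.+ L) ∎
  where open ℕₚ.≤-Reasoning

locating⇒countS-bound : ∀ {S} → IsLocatingCode S → ∀ N → suc (2 ℕ.* N) ≤ 3 ℕ.* countS S N ℕ.+ 15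
locating⇒countS-bound {S} loc N with ℕₚ.≤-total N 7
... | inj₁ N≤7 = ℕₚ.≤-trans (s≤s (ℕₚ.*-monoʳ-≤ 2 N≤7)) (ℕₚ.m≤n+m 15 _)
... | inj₂ 7≤N =
  subst (λ n → suc (2 ℕ.* n) ≤ 3 ℕ.* countS S n ℕ.+ 15) (ℕₚ.m+[n∸m]≡n 7≤N) (beyond-7 (N ∸ 7))
  where
  size : ∀ t → suc (2 ℕ.* (7 ℕ.+ t)) ≡ 15 ℕ.+ 2 ℕ.* t
  size = ℕ-Solver.solve-∀
  twenty-four : ∀ c → 24 ℕ.* c ≡ 3 ℕ.* c ℕ.* 8
  twenty-four = ℕ-Solver.solve-∀
  beyond-7 : ∀ t → suc (2 ℕ.* (7 ℕ.+ t)) ≤ 3 ℕ.* countS S (7 ℕ.+ t) ℕ.+ 15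
  beyond-7 t = begin
    suc (2 ℕ.* (7 ℕ.+ t))  ≡⟨ size t ⟩
    15 ℕ.+ 2 ℕ.* t         ≤⟨ ℕₚ.+-monoʳ-≤ 15 (ℕₚ.*-cancelʳ-≤ (2 ℕ.* t) (3 ℕ.* c) 8 windows) ⟩
    15 ℕ.+ 3 ℕ.* c         ≡⟨ ℕₚ.+-comm 15 _ ⟩
    3 ℕ.* c ℕ.+ 15         ∎
    where
    open ℕₚ.≤-Reasoning
    c : ℕ
    c = countS S (7 ℕ.+ t)
    c≡count : c ≡ count S (ℤ.- + (7 ℕ.+ t)) (15 ℕ.+ 2 ℕ.* t)
    c≡count = trans (countS≡count S (7 ℕ.+ t)) (cong (count S (ℤ.- + (7 ℕ.+ t))) (size t))
    windows : 2 ℕ.* t ℕ.* 8 ≤ 3 ℕ.* c ℕ.* 8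
    windows = subst (2 ℕ.* t ℕ.* 8 ≤_) (trans (cong (24 ℕ.*_) (sym c≡count)) (twenty-four c))
                    (locating⇒count-bound loc (ℤ.- + (7 ℕ.+ t)) (2 ℕ.* t))

scaled-density-bound : ∀ K n c → n ≤ 3 ℕ.* c ℕ.+ 15 → 5 ℕ.* K ≤ n →
  1 ℕ.* K ℕ.* n ≤ 3 ℕ.* K ℕ.* c ℕ.+ 3 ℕ.* n
scaled-density-bound K n c n≤3c+15 5K≤n = begin
  1 ℕ.* K ℕ.* n                      ≡⟨ cong (ℕ._* n) (ℕₚ.*-identityˡ K) ⟩
  K ℕ.* n                            ≤⟨ ℕₚ.*-monoʳ-≤ K n≤3c+15 ⟩
  K ℕ.* (3 ℕ.* c ℕ.+ 15)             ≡⟨ expand K c ⟩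
  3 ℕ.* K ℕ.* c ℕ.+ 3 ℕ.* (5 ℕ.* K)  ≤⟨ ℕₚ.+-monoʳ-≤ (3 ℕ.* K ℕ.* c) (ℕₚ.*-monoʳ-≤ 3 5K≤n) ⟩
  3 ℕ.* K ℕ.* c ℕ.+ 3 ℕ.* n          ∎
  where
  open ℕₚ.≤-Reasoning
  expand : ∀ K c → K ℕ.* (3 ℕ.* c ℕ.+ 15) ≡ 3 ℕ.* K ℕ.* c ℕ.+ 3 ℕ.* (5 ℕ.* K)
  expand = ℕ-Solver.solve-∀

theorem2 : (S : Subsetℤ) → IsLocatingCode S → DensityAtLeast S 1 3
theorem2 S loc k M = N , ℕₚ.m≤m+n M _ ,
  scaled-density-bound (suc k) (suc (2 ℕ.* N)) (countS S N) (locating⇒countS-bound loc N) 5K≤size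
  where
  N : ℕ
  N = M ℕ.+ 5 ℕ.* suc k
  5K≤size : 5 ℕ.* suc k ≤ suc (2 ℕ.* N)
  5K≤size = ℕₚ.≤-trans (ℕₚ.m≤n+m _ M) (ℕₚ.≤-trans (ℕₚ.m≤m+n N _) (ℕₚ.n≤1+n _))
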